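{- Let $\mathbf d$ be a graphical sequence of length $n$ with $\sum_i d_i=dn$, and let $\Delta=\max_i d_i$. Then for any $a$ and $v$ in $[n]$, $$P_{av}(\mathbf d)\le\frac{\Delta^2}{dn\big(1-\Delta(\Delta+2)/dn\big)}.$$
   Context: A sequence is graphical if it is the degree sequence of some simple graph on vertex set $[n]$ (vertex $i$ having degree $d_i$). $P_{av}(\mathbf d)$ is the probability that $av$ is an edge of a graph chosen uniformly at random from all simple graphs on $[n]$ with degree sequence $\mathbf d$. Here $\Delta(\Delta+2)/dn$ means $\Delta(\Delta+2)/(dn)$. -}

module Defs where

open import Data.Nat using (ℕ; zero; suc; _+_; _*_; _<_; _⊔_; _<ᵇ_; _≡ᵇ_)
open import Data.Bool using (Bool; true; false; _∧_; _∨_; if_then_else_)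
open import Data.Fin using (Fin; toℕ)
open import Data.Fin.Properties using () renaming (_≟_ to _≟F_)
open import Data.List using (List; []; _∷_; length; filter; concatMap; map; foldr; allFin; _++_)
open import Data.Bool.ListAction using (any; all)
open import Data.Nat.ListAction using (sum)
open import Data.Vec using (Vec; []; _∷_)
open import Data.Product using (_×_; _,_; proj₁; proj₂; Σ)
open import Relation.Nullary.Decidable using (⌊_⌋)
open import Relation.Binary.PropositionalEquality using (_≡_)

-- Unordered pairs {i,j} of distinct vertices of [n], represented as (i , j) with i < j.
upperPairs : (n : ℕ) → List (Fin n × Fin n)
upperPairs n = concatMap (λ i → concatMap (λ j → if toℕ i <ᵇ toℕ j then (i , j) ∷ [] else []) (allFin n)) (allFin n)

-- A simple graph on vertex set [n]: a choice (Bool) for each potential edge {i,j}.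
-- Distinct vectors are distinct graphs, so this is exactly the set of simple graphs on [n].
Graph : ℕ → Set
Graph n = Vec Bool (length (upperPairs n))

allBoolVecs : (m : ℕ) → List (Vec Bool m)
allBoolVecs zero = [] ∷ []
allBoolVecs (suc m) = map (true ∷_) (allBoolVecs m) ++ map (false ∷_) (allBoolVecs m)

allGraphs : (n : ℕ) → List (Graph n)
allGraphs n = allBoolVecs (length (upperPairs n))

select : {A : Set} → (ps : List A) → Vec Bool (length ps) → List A
select [] [] = []
select (p ∷ ps) (true ∷ bs) = p ∷ select ps bs
select (p ∷ ps) (false ∷ bs) = select ps bs

edges : {n : ℕ} → Graph n → List (Fin n × Fin n)
edges {n} g = select (upperPairs n) g

_==F_ : {n : ℕ} → Fin n → Fin n → Bool
i ==F j = ⌊ i ≟F j ⌋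

degree : {n : ℕ} → Graph n → Fin n → ℕ
degree g i = length (filter (λ e → (i ≟F proj₁ e) Relation.Nullary.Decidable.⊎-dec (i ≟F proj₂ e)) (edges g))
  where import Relation.Nullary.Decidable

adjacentᵇ : {n : ℕ} → Graph n → Fin n → Fin n → Bool
adjacentᵇ g a v = any (λ e → ((a ==F proj₁ e) ∧ (v ==F proj₂ e)) ∨ ((v ==F proj₁ e) ∧ (a ==F proj₂ e))) (edges g)

hasDegSeqᵇ : {n : ℕ} → Graph n → (Fin n → ℕ) → Bool
hasDegSeqᵇ {n} g d = all (λ i → degree g i ≡ᵇ d i) (allFin n)

Graphical : {n : ℕ} → (Fin n → ℕ) → Set
Graphical {n} d = Σ (Graph n) (λ g → (i : Fin n) → degree g i ≡ d i)

numGraphs : {n : ℕ} → (Fin n → ℕ) → ℕ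
numGraphs {n} d = length (filter (λ g → hasDegSeqᵇ g d Data.Bool.≟ true) (allGraphs n))
  where import Data.Bool

numGraphsWithEdge : {n : ℕ} → (Fin n → ℕ) → Fin n → Fin n → ℕ
numGraphsWithEdge {n} d a v =
  length (filter (λ g → (hasDegSeqᵇ g d ∧ adjacentᵇ g a v) Data.Bool.≟ true) (allGraphs n))
  where import Data.Bool

maxDeg : {n : ℕ} → (Fin n → ℕ) → ℕ
maxDeg {n} d = foldr _⊔_ 0 (map d (allFin n))

degSum : {n : ℕ} → (Fin n → ℕ) → ℕ
degSum {n} d = sum (map d (allFin n))

-- Proof by switching.  Let K₁ and K₀ count the graphs of G(d) (degree sequence d) with and
-- without the edge av.  For x, y with a, v, x, y distinct, (x , y) is a forward configuration
-- of g if av, xy are edges and ax, vy are not, and a backward one if ax, vy are edges and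
-- av, xy are not.  Toggling the four pairs of the cycle a v y x (the switching) turns forward
-- configurations into backward ones, is invertible and keeps all degrees, so over G(d) both
-- kinds are equally many.  A graph with av has at least dn − 2(1 + Δ)Δ forward
-- configurations (every ordered edge xy qualifies unless x is a or a neighbour of a, or y is v
-- or a neighbour of v), and a graph without av has at most Δ² backward ones.  Hence
-- K₁ dn ≤ K₀ Δ² + 2 K₁ (1 + Δ)Δ, i.e. K₁ (dn − Δ(Δ + 2)) ≤ Δ² (K₀ + K₁).
module Submission where

open import Data.Bool using (Bool; true; false; _∧_; _∨_; not; _xor_; if_then_else_; T)
import Data.Bool as Bool
open import Data.Bool.ListAction using (any; or; and)
open import Data.Bool.Properties using (∨-comm; ∧-comm; ∧-zeroʳ; ∨-zeroʳ; ∧-distribˡ-∨; not-involutive)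
open import Data.Empty using (⊥-elim)
open import Data.Fin using (Fin; toℕ) renaming (zero to fzero; suc to fsuc)
open import Data.Fin.Properties using (toℕ-injective) renaming (_≟_ to _≟F_)
open import Data.List using (List; []; _∷_; map; foldr; allFin; tabulate; _++_; concatMap; length; filter)
open import Data.List.Membership.Propositional using (_∈_)
open import Data.List.Membership.Propositional.Properties using (∈-map⁺; ∈-allFin)
open import Data.List.Properties using (map-cong)
open import Data.List.Relation.Unary.All as All using (All; []; _∷_)
open import Data.List.Relation.Unary.All.Properties using (concat⁺; map⁺; tabulate⁺; all⁺)
open import Data.List.Relation.Unary.Any using (here; there)
open import Data.Nat using (ℕ; zero; suc; _+_; _*_; _∸_; _<_; _≤_; _⊔_; z≤n; s≤s; _<ᵇ_; _≡ᵇ_)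
open import Data.Nat.ListAction using (sum)
open import Data.Nat.Properties
open import Algebra.Properties.CommutativeSemigroup +-commutativeSemigroup using (interchange; x∙yz≈y∙xz)
open import Algebra.Properties.Semiring.Sum +-*-semiring
  using (sum-syntax; sum-cong-≗; sum-replicate-zero; ∑-distrib-+; ∑-comm; *-distribˡ-sum; *-distribʳ-sum)
  renaming (sum to ∑)
open import Data.Nat.Solver using (module +-*-Solver)
open +-*-Solver using (solve; _:+_; _:*_; _:=_; con)
open import Data.Product using (_×_; _,_; proj₁; proj₂)
open import Data.Sum using (_⊎_; inj₁; inj₂)
open import Data.Unit using (tt)
open import Data.Vec using (Vec; []; _∷_)
open import Function using (case_of_)
open import Relation.Binary.PropositionalEquality
open import Relation.Nullary using (Dec; yes; no; does)
open import Relation.Nullary.Decidable using (isYes≗does; _⊎-dec_)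
open import Defs

⟦_⟧ : Bool → ℕ
⟦ true ⟧ = 1
⟦ false ⟧ = 0

⟦⟧-injective : ∀ {b c} → ⟦ b ⟧ ≡ ⟦ c ⟧ → b ≡ c
⟦⟧-injective {true} {true} _ = refl
⟦⟧-injective {false} {false} _ = refl

⟦∧⟧ : ∀ b c → ⟦ b ∧ c ⟧ ≡ ⟦ b ⟧ * ⟦ c ⟧
⟦∧⟧ true c = sym (+-identityʳ ⟦ c ⟧)
⟦∧⟧ false c = refl

⟦∨⟧-≤ : ∀ b c → ⟦ b ∨ c ⟧ ≤ ⟦ b ⟧ + ⟦ c ⟧
⟦∨⟧-≤ true c = s≤s z≤n
⟦∨⟧-≤ false c = ≤-refl

⟦∨⟧-disjoint : ∀ b c → b ∧ c ≡ false → ⟦ b ∨ c ⟧ ≡ ⟦ b ⟧ + ⟦ c ⟧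
⟦∨⟧-disjoint true false _ = refl
⟦∨⟧-disjoint false c _ = refl

-- Toggling b by t: the new bit plus the removed part equals the old bit plus the added part.
⟦xor⟧-balance : ∀ t b → ⟦ t xor b ⟧ + ⟦ t ∧ b ⟧ ≡ ⟦ b ⟧ + ⟦ t ∧ not b ⟧
⟦xor⟧-balance true true = refl
⟦xor⟧-balance true false = refl
⟦xor⟧-balance false b = refl

⟦∨∧⟧-disjoint : ∀ b₁ b₂ c → b₁ ∧ b₂ ≡ false → ⟦ (b₁ ∨ b₂) ∧ c ⟧ ≡ ⟦ b₁ ∧ c ⟧ + ⟦ b₂ ∧ c ⟧
⟦∨∧⟧-disjoint true false c _ = sym (+-identityʳ ⟦ c ⟧)
⟦∨∧⟧-disjoint false b₂ c _ = refl

∧-∨-false : ∀ b c₁ c₂ → b ∧ c₁ ≡ false → b ∧ c₂ ≡ false → b ∧ (c₁ ∨ c₂) ≡ false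
∧-∨-false b c₁ c₂ e₁ e₂ = trans (∧-distribˡ-∨ b c₁ c₂) (cong₂ _∨_ e₁ e₂)

∧-true : ∀ {b c} → b ∧ c ≡ true → (b ≡ true) × (c ≡ true)
∧-true {true} {true} _ = refl , refl

⟦∧⟧*-bound : ∀ b c {m k l} → (b ≡ true → c ≡ true → m ≤ k + l) → ⟦ b ∧ c ⟧ * m ≤ ⟦ b ⟧ * k + ⟦ b ∧ c ⟧ * l
⟦∧⟧*-bound false c h = z≤n
⟦∧⟧*-bound true false h = z≤n
⟦∧⟧*-bound true true {m} {k} {l} h =
  subst₂ _≤_ (sym (+-identityʳ m)) (cong₂ _+_ (sym (+-identityʳ k)) (sym (+-identityʳ l))) (h refl refl)

⟦⟧*-bound : ∀ b c {m k} → (b ≡ true → m ≤ ⟦ c ⟧ * k) → ⟦ b ⟧ * m ≤ ⟦ b ∧ c ⟧ * k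
⟦⟧*-bound false c h = z≤n
⟦⟧*-bound true c {m} h = subst (_≤ _) (sym (+-identityʳ m)) (h refl)

⟦does⟧ : ∀ b → ⟦ does (b Bool.≟ true) ⟧ ≡ ⟦ b ⟧
⟦does⟧ true = refl
⟦does⟧ false = refl

<ᵇ-trichotomy : ∀ {m k} → m ≢ k → ⟦ m <ᵇ k ⟧ + ⟦ k <ᵇ m ⟧ ≡ 1
<ᵇ-trichotomy {zero} {zero} m≢k = ⊥-elim (m≢k refl)
<ᵇ-trichotomy {zero} {suc k} _ = refl
<ᵇ-trichotomy {suc m} {zero} _ = refl
<ᵇ-trichotomy {suc m} {suc k} m≢k = <ᵇ-trichotomy (λ m≡k → m≢k (cong suc m≡k))

==F-refl : ∀ {n} (i : Fin n) → (i ==F i) ≡ true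
==F-refl i with i ≟F i
... | yes _ = refl
... | no i≢i = ⊥-elim (i≢i refl)

==F-≢ : ∀ {n} {i j : Fin n} → i ≢ j → (i ==F j) ≡ false
==F-≢ {i = i} {j} i≢j with i ≟F j
... | yes i≡j = ⊥-elim (i≢j i≡j)
... | no _ = refl

==F-sym : ∀ {n} (i j : Fin n) → (i ==F j) ≡ (j ==F i)
==F-sym i j with i ≟F j | j ≟F i
... | yes _ | yes _ = refl
... | no _ | no _ = refl
... | yes i≡j | no j≢i = ⊥-elim (j≢i (sym i≡j))
... | no i≢j | yes j≡i = ⊥-elim (i≢j (sym j≡i))

==F-exclusive : ∀ {n} {s t : Fin n} → s ≢ t → ∀ i → (i ==F s) ∧ (i ==F t) ≡ false
==F-exclusive {s = s} {t} s≢t i with i ≟F s | i ≟F t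
... | yes i≡s | yes i≡t = ⊥-elim (s≢t (trans (sym i≡s) i≡t))
... | yes _ | no _ = refl
... | no _ | _ = refl

∑-mono : ∀ {n} {f g : Fin n → ℕ} → (∀ i → f i ≤ g i) → ∑ f ≤ ∑ g
∑-mono {zero} h = z≤n
∑-mono {suc n} h = +-mono-≤ (h fzero) (∑-mono (λ i → h (fsuc i)))

∑-delta : ∀ {n} (i : Fin n) (h : Fin n → ℕ) → ∑[ j < n ] (⟦ i ==F j ⟧ * h j) ≡ h i
∑-delta {suc n} fzero h =
  -- the terms j ≠ 0 vanish definitionally
  trans (cong₂ _+_ (+-identityʳ (h fzero)) (sum-replicate-zero n)) (+-identityʳ (h fzero))
∑-delta {suc n} (fsuc i) h = trans (sum-cong-≗ shift) (∑-delta i (λ j → h (fsuc j)))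
  where
  shift : ∀ j → ⟦ fsuc i ==F fsuc j ⟧ * h (fsuc j) ≡ ⟦ i ==F j ⟧ * h (fsuc j)
  shift j with i ≟F j
  ... | yes _ = refl
  ... | no _ = refl

∑-indicator : ∀ {n} (i : Fin n) → ∑[ j < n ] ⟦ i ==F j ⟧ ≡ 1
∑-indicator i = trans (sum-cong-≗ (λ j → sym (*-identityʳ ⟦ i ==F j ⟧))) (∑-delta i (λ _ → 1))

∑∑-delta : ∀ {n} (s t : Fin n) (h : Fin n → Fin n → ℕ) →
           ∑[ i < n ] ∑[ j < n ] (⟦ s ==F i ⟧ * (⟦ t ==F j ⟧ * h i j)) ≡ h s t
∑∑-delta {n} s t h = begin
  ∑[ i < n ] ∑[ j < n ] (⟦ s ==F i ⟧ * (⟦ t ==F j ⟧ * h i j)) ≡⟨ sum-cong-≗ (λ i → sym (*-distribˡ-sum ⟦ s ==F i ⟧ (λ j → ⟦ t ==F j ⟧ * h i j))) ⟩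
  ∑[ i < n ] (⟦ s ==F i ⟧ * ∑[ j < n ] (⟦ t ==F j ⟧ * h i j)) ≡⟨ ∑-delta s (λ i → ∑[ j < n ] (⟦ t ==F j ⟧ * h i j)) ⟩
  ∑[ j < n ] (⟦ t ==F j ⟧ * h s j)                             ≡⟨ ∑-delta t (h s) ⟩
  h s t                                                        ∎
  where open ≡-Reasoning

∑ₗ : {A : Set} → List A → (A → ℕ) → ℕ
∑ₗ xs f = sum (map f xs)

module _ {A : Set} where

  ∑ₗ-cong : (xs : List A) {f g : A → ℕ} → (∀ x → f x ≡ g x) → ∑ₗ xs f ≡ ∑ₗ xs g
  ∑ₗ-cong [] e = refl
  ∑ₗ-cong (x ∷ xs) e = cong₂ _+_ (e x) (∑ₗ-cong xs e)

  ∑ₗ-cong-All : {xs : List A} {f g : A → ℕ} → All (λ x → f x ≡ g x) xs → ∑ₗ xs f ≡ ∑ₗ xs g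
  ∑ₗ-cong-All [] = refl
  ∑ₗ-cong-All (e ∷ es) = cong₂ _+_ e (∑ₗ-cong-All es)

  ∑ₗ-zero : (xs : List A) → ∑ₗ xs (λ _ → 0) ≡ 0
  ∑ₗ-zero [] = refl
  ∑ₗ-zero (x ∷ xs) = ∑ₗ-zero xs

  ∑ₗ-mono : (xs : List A) {f g : A → ℕ} → (∀ x → f x ≤ g x) → ∑ₗ xs f ≤ ∑ₗ xs g
  ∑ₗ-mono [] e = z≤n
  ∑ₗ-mono (x ∷ xs) e = +-mono-≤ (e x) (∑ₗ-mono xs e)

  ∑ₗ-+ : (xs : List A) (f g : A → ℕ) → ∑ₗ xs (λ x → f x + g x) ≡ ∑ₗ xs f + ∑ₗ xs g
  ∑ₗ-+ [] f g = refl
  ∑ₗ-+ (x ∷ xs) f g =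
    trans (cong (f x + g x +_) (∑ₗ-+ xs f g)) (interchange (f x) (g x) (∑ₗ xs f) (∑ₗ xs g))

  ∑ₗ-*ʳ : (xs : List A) (f : A → ℕ) (c : ℕ) → ∑ₗ xs (λ x → f x * c) ≡ ∑ₗ xs f * c
  ∑ₗ-*ʳ [] f c = refl
  ∑ₗ-*ʳ (x ∷ xs) f c = trans (cong (f x * c +_) (∑ₗ-*ʳ xs f c)) (sym (*-distribʳ-+ c (f x) (∑ₗ xs f)))

  ∑ₗ-++ : (xs ys : List A) (f : A → ℕ) → ∑ₗ (xs ++ ys) f ≡ ∑ₗ xs f + ∑ₗ ys f
  ∑ₗ-++ [] ys f = refl
  ∑ₗ-++ (x ∷ xs) ys f = trans (cong (f x +_) (∑ₗ-++ xs ys f)) (sym (+-assoc (f x) (∑ₗ xs f) (∑ₗ ys f)))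

  ∑ₗ-∑ : (xs : List A) {n : ℕ} (f : A → Fin n → ℕ) →
         ∑ₗ xs (λ x → ∑[ i < n ] f x i) ≡ ∑[ i < n ] ∑ₗ xs (λ x → f x i)
  ∑ₗ-∑ [] {n} f = sym (sum-replicate-zero n)
  ∑ₗ-∑ (x ∷ xs) f = trans (cong (∑ (f x) +_) (∑ₗ-∑ xs f)) (sym (∑-distrib-+ (f x) _))

module _ {A B : Set} where

  ∑ₗ-map : (g : A → B) (xs : List A) (f : B → ℕ) → ∑ₗ (map g xs) f ≡ ∑ₗ xs (λ x → f (g x))
  ∑ₗ-map g [] f = refl
  ∑ₗ-map g (x ∷ xs) f = cong (f (g x) +_) (∑ₗ-map g xs f)

  ∑ₗ-concatMap : (h : A → List B) (xs : List A) (f : B → ℕ) →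
                 ∑ₗ (concatMap h xs) f ≡ ∑ₗ xs (λ x → ∑ₗ (h x) f)
  ∑ₗ-concatMap h [] f = refl
  ∑ₗ-concatMap h (x ∷ xs) f =
    trans (∑ₗ-++ (h x) (concatMap h xs) f) (cong (∑ₗ (h x) f +_) (∑ₗ-concatMap h xs f))

∑ₗ-allFin : ∀ n (f : Fin n → ℕ) → ∑ₗ (allFin n) f ≡ ∑ f
∑ₗ-allFin n f = ∑ₗ-tabulate n (λ i → i)
  where
  ∑ₗ-tabulate : ∀ m (g : Fin m → Fin n) → ∑ₗ (tabulate g) f ≡ ∑[ i < m ] f (g i)
  ∑ₗ-tabulate zero g = refl
  ∑ₗ-tabulate (suc m) g = cong (f (g fzero) +_) (∑ₗ-tabulate m (λ i → g (fsuc i)))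

module _ {A : Set} where

  ∑ₗ-select-≤ : (ps : List A) (g : Vec Bool (length ps)) (f : A → ℕ) → ∑ₗ (select ps g) f ≤ ∑ₗ ps f
  ∑ₗ-select-≤ [] [] f = z≤n
  ∑ₗ-select-≤ (p ∷ ps) (true ∷ g) f = +-monoʳ-≤ (f p) (∑ₗ-select-≤ ps g f)
  ∑ₗ-select-≤ (p ∷ ps) (false ∷ g) f = ≤-trans (∑ₗ-select-≤ ps g f) (m≤n+m _ (f p))

  All-select : {P : A → Set} (ps : List A) (g : Vec Bool (length ps)) → All P ps → All P (select ps g)
  All-select [] [] [] = []
  All-select (p ∷ ps) (true ∷ g) (Pp ∷ Pps) = Pp ∷ All-select ps g Pps
  All-select (p ∷ ps) (false ∷ g) (_ ∷ Pps) = All-select ps g Pps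

  any-count : (Q : A → Bool) (xs : List A) → ∑ₗ xs (λ x → ⟦ Q x ⟧) ≤ 1 → ⟦ any Q xs ⟧ ≡ ∑ₗ xs (λ x → ⟦ Q x ⟧)
  any-count Q [] _ = refl
  any-count Q (x ∷ xs) ≤1 with Q x
  ... | false = any-count Q xs ≤1
  ... | true with ∑ₗ xs (λ x → ⟦ Q x ⟧) | ≤1
  ...   | zero | _ = refl
  ...   | suc _ | s≤s ()

  length-filter : {P : A → Set} (P? : (x : A) → Dec (P x)) (xs : List A) →
                  length (filter P? xs) ≡ ∑ₗ xs (λ x → ⟦ does (P? x) ⟧)
  length-filter P? [] = refl
  length-filter P? (x ∷ xs) with does (P? x)
  ... | true = cong suc (length-filter P? xs)
  ... | false = length-filter P? xs

≤-foldr-⊔ : ∀ {m ms} → m ∈ ms → m ≤ foldr _⊔_ 0 ms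
≤-foldr-⊔ (here refl) = m≤m⊔n _ _
≤-foldr-⊔ {ms = k ∷ _} (there m∈ms) = ≤-trans (≤-foldr-⊔ m∈ms) (m≤n⊔m k _)

-- Unordered pairs of vertices.  isPair s t p says that p is the pair {s,t},
-- i.e. p = (s , t) or p = (t , s); this is exactly the test used by adjacentᵇ.
isPair : ∀ {n} → Fin n → Fin n → Fin n × Fin n → Bool
isPair s t p = ((s ==F proj₁ p) ∧ (t ==F proj₂ p)) ∨ ((t ==F proj₁ p) ∧ (s ==F proj₂ p))

Proper : ∀ {n} → Fin n × Fin n → Set
Proper p = proj₁ p ≢ proj₂ p

module _ {n : ℕ} where

  isPair-self : (s t : Fin n) → isPair s t (s , t) ≡ true
  isPair-self s t rewrite ==F-refl s | ==F-refl t = refl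

  isPair-flip : (s t i j : Fin n) → isPair s t (i , j) ≡ isPair s t (j , i)
  isPair-flip s t i j = trans (∨-comm ((s ==F i) ∧ (t ==F j)) ((t ==F i) ∧ (s ==F j)))
    (cong₂ _∨_ (∧-comm (t ==F i) (s ==F j)) (∧-comm (s ==F i) (t ==F j)))

  isPair-sym : (s t : Fin n) (p : Fin n × Fin n) → isPair s t p ≡ isPair t s p
  isPair-sym s t p = ∨-comm ((s ==F proj₁ p) ∧ (t ==F proj₂ p)) ((t ==F proj₁ p) ∧ (s ==F proj₂ p))

  isPair-swap : (s t i j : Fin n) → isPair s t (i , j) ≡ isPair i j (s , t)
  isPair-swap s t i j = cong₂ _∨_ (cong₂ _∧_ (==F-sym s i) (==F-sym t j))
    (trans (cong₂ _∧_ (==F-sym t i) (==F-sym s j)) (∧-comm (i ==F t) (j ==F s)))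

  isPair-sound : (s t : Fin n) (p : Fin n × Fin n) → isPair s t p ≡ true → (p ≡ (s , t)) ⊎ (p ≡ (t , s))
  isPair-sound s t (i , j) e with s ≟F i | t ≟F j | t ≟F i | s ≟F j
  ... | yes s≡i | yes t≡j | _ | _ = inj₁ (sym (cong₂ _,_ s≡i t≡j))
  ... | yes _ | no _ | yes t≡i | yes s≡j = inj₂ (sym (cong₂ _,_ t≡i s≡j))
  ... | no _ | _ | yes t≡i | yes s≡j = inj₂ (sym (cong₂ _,_ t≡i s≡j))

  apart : {s t : Fin n} → s ≢ t → ∀ i → (s ==F i) ∧ (t ==F i) ≡ false
  apart {s} {t} s≢t i = trans (cong₂ _∧_ (==F-sym s i) (==F-sym t i)) (==F-exclusive s≢t i)

  isPair-diagonal : {s t : Fin n} → s ≢ t → ∀ i → isPair s t (i , i) ≡ false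
  isPair-diagonal s≢t i = cong₂ _∨_ (apart s≢t i) (apart (≢-sym s≢t) i)

  isPair-improper : (i : Fin n) (p : Fin n × Fin n) → Proper p → isPair i i p ≡ false
  isPair-improper i p proper rewrite ==F-exclusive proper i = refl

  isPair-split : {s t : Fin n} → s ≢ t → ∀ i j →
                 ⟦ isPair s t (i , j) ⟧ ≡ ⟦ s ==F i ⟧ * ⟦ t ==F j ⟧ + ⟦ t ==F i ⟧ * ⟦ s ==F j ⟧
  isPair-split {s} {t} s≢t i j = begin
    ⟦ isPair s t (i , j) ⟧                                  ≡⟨ ⟦∨⟧-disjoint ((s ==F i) ∧ (t ==F j)) ((t ==F i) ∧ (s ==F j))
                                                                (disjoint (s ==F i) (t ==F i) (t ==F j) (s ==F j) (apart s≢t i)) ⟩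
    ⟦ (s ==F i) ∧ (t ==F j) ⟧ + ⟦ (t ==F i) ∧ (s ==F j) ⟧  ≡⟨ cong₂ _+_ (⟦∧⟧ (s ==F i) (t ==F j)) (⟦∧⟧ (t ==F i) (s ==F j)) ⟩
    ⟦ s ==F i ⟧ * ⟦ t ==F j ⟧ + ⟦ t ==F i ⟧ * ⟦ s ==F j ⟧  ∎
    where
    open ≡-Reasoning
    disjoint : ∀ x₁ x₂ y₁ y₂ → x₁ ∧ x₂ ≡ false → (x₁ ∧ y₁) ∧ (x₂ ∧ y₂) ≡ false
    disjoint true true y₁ y₂ ()
    disjoint true false y₁ y₂ _ = ∧-zeroʳ y₁
    disjoint false x₂ y₁ y₂ _ = refl

  ends : Fin n → Fin n → Fin n → ℕ
  ends s t i = ⟦ s ==F i ⟧ + ⟦ t ==F i ⟧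

  ∑-isPair : {s t : Fin n} → s ≢ t → ∀ i → ∑[ j < n ] ⟦ isPair s t (i , j) ⟧ ≡ ends s t i
  ∑-isPair {s} {t} s≢t i = begin
    ∑[ j < n ] ⟦ isPair s t (i , j) ⟧                                  ≡⟨ sum-cong-≗ (isPair-split s≢t i) ⟩
    ∑[ j < n ] (⟦ s ==F i ⟧ * ⟦ t ==F j ⟧ + ⟦ t ==F i ⟧ * ⟦ s ==F j ⟧) ≡⟨ ∑-distrib-+ (at s t) (at t s) ⟩
    ∑ (at s t) + ∑ (at t s)                                             ≡⟨ cong₂ _+_ (endpoint s t) (endpoint t s) ⟩
    ⟦ s ==F i ⟧ + ⟦ t ==F i ⟧                                           ∎
    where
    open ≡-Reasoning
    at : Fin n → Fin n → Fin n → ℕ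
    at u w j = ⟦ u ==F i ⟧ * ⟦ w ==F j ⟧
    endpoint : ∀ u w → ∑ (at u w) ≡ ⟦ u ==F i ⟧
    endpoint u w = begin
      ∑[ j < n ] (⟦ u ==F i ⟧ * ⟦ w ==F j ⟧) ≡⟨ *-distribˡ-sum ⟦ u ==F i ⟧ (λ j → ⟦ w ==F j ⟧) ⟨
      ⟦ u ==F i ⟧ * ∑[ j < n ] ⟦ w ==F j ⟧   ≡⟨ cong (⟦ u ==F i ⟧ *_) (∑-indicator w) ⟩
      ⟦ u ==F i ⟧ * 1                        ≡⟨ *-identityʳ ⟦ u ==F i ⟧ ⟩
      ⟦ u ==F i ⟧                            ∎

  private
    refute : ∀ {u u′ w w′ : Fin n} → (u ≢ u′ ⊎ w ≢ w′) → u ≡ u′ → w ≡ w′ → true ≡ false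
    refute (inj₁ u≢u′) u≡u′ _ = ⊥-elim (u≢u′ u≡u′)
    refute (inj₂ w≢w′) _ w≡w′ = ⊥-elim (w≢w′ w≡w′)

  isPair-disjoint : {s t s′ t′ : Fin n} → (s ≢ s′ ⊎ t ≢ t′) → (s ≢ t′ ⊎ t ≢ s′) →
                    ∀ p → isPair s t p ∧ isPair s′ t′ p ≡ false
  isPair-disjoint {s} {t} {s′} {t′} straight crossed p with isPair s t p in e | isPair s′ t′ p in e′
  ... | false | _ = refl
  ... | true | false = refl
  ... | true | true with isPair-sound s t p e | isPair-sound s′ t′ p e′
  ...   | inj₁ refl | inj₁ p≡ = refute straight (cong proj₁ p≡) (cong proj₂ p≡)
  ...   | inj₁ refl | inj₂ p≡ = refute crossed (cong proj₁ p≡) (cong proj₂ p≡)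
  ...   | inj₂ refl | inj₁ p≡ = refute crossed (cong proj₂ p≡) (cong proj₁ p≡)
  ...   | inj₂ refl | inj₂ p≡ = refute straight (cong proj₂ p≡) (cong proj₁ p≡)

  ∑-isPair-∧ : {s t : Fin n} → s ≢ t → (F : Fin n → Fin n → Bool) → (∀ i j → F i j ≡ F j i) → ∀ i →
               ∑[ j < n ] ⟦ isPair s t (i , j) ∧ F i j ⟧ ≡ ends s t i * ⟦ F s t ⟧
  ∑-isPair-∧ {s} {t} s≢t F F-sym i = begin
    ∑[ j < n ] ⟦ isPair s t (i , j) ∧ F i j ⟧           ≡⟨ sum-cong-≗ on-pair ⟩
    ∑[ j < n ] (⟦ isPair s t (i , j) ⟧ * ⟦ F s t ⟧)     ≡⟨ *-distribʳ-sum ⟦ F s t ⟧ (λ j → ⟦ isPair s t (i , j) ⟧) ⟨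
    ∑[ j < n ] ⟦ isPair s t (i , j) ⟧ * ⟦ F s t ⟧       ≡⟨ cong (_* ⟦ F s t ⟧) (∑-isPair s≢t i) ⟩
    ends s t i * ⟦ F s t ⟧                               ∎
    where
    open ≡-Reasoning
    on-pair : ∀ j → ⟦ isPair s t (i , j) ∧ F i j ⟧ ≡ ⟦ isPair s t (i , j) ⟧ * ⟦ F s t ⟧
    on-pair j with isPair s t (i , j) in e
    ... | false = refl
    ... | true with isPair-sound s t (i , j) e
    ...   | inj₁ refl = sym (+-identityʳ _)
    ...   | inj₂ refl = trans (cong ⟦_⟧ (F-sym t s)) (sym (+-identityʳ _))

module _ {n : ℕ} where

  private
    ordered : (i j : Fin n) → List (Fin n × Fin n)
    ordered i j = if toℕ i <ᵇ toℕ j then (i , j) ∷ [] else []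

  upperPairs-proper : All Proper (upperPairs n)
  upperPairs-proper = concat⁺ (map⁺ (tabulate⁺ λ i → concat⁺ (map⁺ (tabulate⁺ λ j → proper i j))))
    where
    proper : (i j : Fin n) → All Proper (ordered i j)
    proper i j with toℕ i <ᵇ toℕ j in i<j
    ... | false = []
    ... | true = (λ i≡j → <-irrefl (cong toℕ i≡j) (<ᵇ⇒< (toℕ i) (toℕ j) (subst T (sym i<j) tt))) ∷ []

  ∑ₗ-upperPairs : (f : Fin n × Fin n → ℕ) →
                  ∑ₗ (upperPairs n) f ≡ ∑[ i < n ] ∑[ j < n ] (⟦ toℕ i <ᵇ toℕ j ⟧ * f (i , j))
  ∑ₗ-upperPairs f = trans (∑ₗ-concatMap _ (allFin n) f) (trans (∑ₗ-cong (allFin n) row) (∑ₗ-allFin n _))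
    where
    entry : (i j : Fin n) → ∑ₗ (ordered i j) f ≡ ⟦ toℕ i <ᵇ toℕ j ⟧ * f (i , j)
    entry i j with toℕ i <ᵇ toℕ j
    ... | false = refl
    ... | true = refl
    row : ∀ i → ∑ₗ (concatMap (ordered i) (allFin n)) f ≡ ∑[ j < n ] (⟦ toℕ i <ᵇ toℕ j ⟧ * f (i , j))
    row i = trans (∑ₗ-concatMap (ordered i) (allFin n) f) (trans (∑ₗ-cong (allFin n) (entry i)) (∑ₗ-allFin n _))

  upperPairs-once : {s t : Fin n} → s ≢ t → ∑ₗ (upperPairs n) (λ p → ⟦ isPair s t p ⟧) ≡ 1
  upperPairs-once {s} {t} s≢t = begin
    ∑ₗ (upperPairs n) (λ p → ⟦ isPair s t p ⟧)                                    ≡⟨ ∑ₗ-upperPairs _ ⟩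
    ∑[ i < n ] ∑[ j < n ] (⟦ toℕ i <ᵇ toℕ j ⟧ * ⟦ isPair s t (i , j) ⟧)          ≡⟨ sum-cong-≗ (λ i → sum-cong-≗ (split i)) ⟩
    ∑[ i < n ] ∑[ j < n ] (st i j + ts i j)                                          ≡⟨ sum-cong-≗ (λ i → ∑-distrib-+ (st i) (ts i)) ⟩
    ∑[ i < n ] (∑[ j < n ] st i j + ∑[ j < n ] ts i j)                               ≡⟨ ∑-distrib-+ (λ i → ∑[ j < n ] st i j) (λ i → ∑[ j < n ] ts i j) ⟩
    ∑[ i < n ] ∑[ j < n ] st i j + ∑[ i < n ] ∑[ j < n ] ts i j                     ≡⟨ cong₂ _+_ (∑∑-delta s t lt) (∑∑-delta t s lt) ⟩
    ⟦ toℕ s <ᵇ toℕ t ⟧ + ⟦ toℕ t <ᵇ toℕ s ⟧                                        ≡⟨ <ᵇ-trichotomy (λ e → s≢t (toℕ-injective e)) ⟩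
    1                                                                                 ∎
    where
    open ≡-Reasoning
    lt : Fin n → Fin n → ℕ
    lt i j = ⟦ toℕ i <ᵇ toℕ j ⟧
    st ts : Fin n → Fin n → ℕ
    st i j = ⟦ s ==F i ⟧ * (⟦ t ==F j ⟧ * lt i j)
    ts i j = ⟦ t ==F i ⟧ * (⟦ s ==F j ⟧ * lt i j)
    split : ∀ i j → lt i j * ⟦ isPair s t (i , j) ⟧ ≡ st i j + ts i j
    split i j rewrite isPair-split s≢t i j =
      solve 5 (λ l a b c d → l :* (a :* b :+ c :* d) := a :* (b :* l) :+ c :* (d :* l)) refl
        (lt i j) ⟦ s ==F i ⟧ ⟦ t ==F j ⟧ ⟦ t ==F i ⟧ ⟦ s ==F j ⟧

  upperPairs-improper : (i : Fin n) → ∑ₗ (upperPairs n) (λ p → ⟦ isPair i i p ⟧) ≡ 0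
  upperPairs-improper i =
    trans (∑ₗ-cong-All (All.map (λ proper → cong ⟦_⟧ (isPair-improper i _ proper)) upperPairs-proper))
          (∑ₗ-zero (upperPairs n))

module _ {n : ℕ} (g : Graph n) where

  private
    A : Fin n → Fin n → Bool
    A = adjacentᵇ g

  adjacency-count : (s t : Fin n) → ⟦ A s t ⟧ ≡ ∑ₗ (edges g) (λ p → ⟦ isPair s t p ⟧)
  adjacency-count s t = any-count (isPair s t) (edges g)
    (≤-trans (∑ₗ-select-≤ (upperPairs n) g _) (at-most-once s t))
    where
    at-most-once : ∀ s t → ∑ₗ (upperPairs n) (λ p → ⟦ isPair s t p ⟧) ≤ 1
    at-most-once s t with s ≟F t
    ... | yes refl = ≤-trans (≤-reflexive (upperPairs-improper s)) z≤n
    ... | no s≢t = ≤-reflexive (upperPairs-once s≢t)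

  adjacent-irrefl : (i : Fin n) → A i i ≡ false
  adjacent-irrefl i = ⟦⟧-injective (n≤0⇒n≡0 (begin
    ⟦ A i i ⟧                                    ≡⟨ adjacency-count i i ⟩
    ∑ₗ (edges g) (λ p → ⟦ isPair i i p ⟧)        ≤⟨ ∑ₗ-select-≤ (upperPairs n) g _ ⟩
    ∑ₗ (upperPairs n) (λ p → ⟦ isPair i i p ⟧)   ≡⟨ upperPairs-improper i ⟩
    0                                            ∎))
    where open ≤-Reasoning

  adjacent-sym : (s t : Fin n) → A s t ≡ A t s
  adjacent-sym s t = cong or (map-cong (isPair-sym s t) (edges g))

  degree-adjacency : (i : Fin n) → degree g i ≡ ∑[ j < n ] ⟦ A i j ⟧
  degree-adjacency i = begin
    degree g i                                              ≡⟨ length-filter (λ p → (i ≟F proj₁ p) ⊎-dec (i ≟F proj₂ p)) (edges g) ⟩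
    ∑ₗ (edges g) (λ p → ⟦ does (i ≟F proj₁ p) ∨ does (i ≟F proj₂ p) ⟧)
      ≡⟨ ∑ₗ-cong-All (All.map (incidence _) (All-select (upperPairs n) g upperPairs-proper)) ⟩
    ∑ₗ (edges g) (λ p → ∑[ j < n ] ⟦ isPair i j p ⟧)     ≡⟨ ∑ₗ-∑ (edges g) (λ p j → ⟦ isPair i j p ⟧) ⟩
    ∑[ j < n ] ∑ₗ (edges g) (λ p → ⟦ isPair i j p ⟧)     ≡⟨ sum-cong-≗ (λ j → sym (adjacency-count i j)) ⟩
    ∑[ j < n ] ⟦ A i j ⟧                                    ∎
    where
    open ≡-Reasoning
    incidence : (p : Fin n × Fin n) → Proper p →
                ⟦ does (i ≟F proj₁ p) ∨ does (i ≟F proj₂ p) ⟧ ≡ ∑[ j < n ] ⟦ isPair i j p ⟧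
    incidence (p₁ , p₂) p₁≢p₂ = begin
      ⟦ does (i ≟F p₁) ∨ does (i ≟F p₂) ⟧   ≡⟨ cong₂ (λ x y → ⟦ x ∨ y ⟧) (sym (isYes≗does (i ≟F p₁))) (sym (isYes≗does (i ≟F p₂))) ⟩
      ⟦ (i ==F p₁) ∨ (i ==F p₂) ⟧           ≡⟨ ⟦∨⟧-disjoint (i ==F p₁) (i ==F p₂) (==F-exclusive p₁≢p₂ i) ⟩
      ⟦ i ==F p₁ ⟧ + ⟦ i ==F p₂ ⟧           ≡⟨ cong₂ _+_ (cong ⟦_⟧ (==F-sym i p₁)) (cong ⟦_⟧ (==F-sym i p₂)) ⟩
      ⟦ p₁ ==F i ⟧ + ⟦ p₂ ==F i ⟧           ≡⟨ sym (∑-isPair p₁≢p₂ i) ⟩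
      ∑[ j < n ] ⟦ isPair p₁ p₂ (i , j) ⟧   ≡⟨ sum-cong-≗ (λ j → cong ⟦_⟧ (isPair-swap p₁ p₂ i j)) ⟩
      ∑[ j < n ] ⟦ isPair i j (p₁ , p₂) ⟧   ∎

toggle : {A : Set} (R : A → Bool) (ps : List A) → Vec Bool (length ps) → Vec Bool (length ps)
toggle R [] [] = []
toggle R (p ∷ ps) (b ∷ bs) = (R p xor b) ∷ toggle R ps bs

module _ {A : Set} where

  -- toggling is a bijection of the set of all vectors, so it does not change sums over them
  toggle-invariance : (R : A → Bool) (ps : List A) (h : Vec Bool (length ps) → ℕ) →
    ∑ₗ (allBoolVecs (length ps)) h ≡ ∑ₗ (allBoolVecs (length ps)) (λ g → h (toggle R ps g))
  toggle-invariance R [] h = refl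
  toggle-invariance R (p ∷ ps) h = begin
    ∑ₗ (allBoolVecs (suc (length ps))) h                               ≡⟨ halves h ⟩
    ∑ₗ L (λ g → h (true ∷ g)) + ∑ₗ L (λ g → h (false ∷ g))           ≡⟨ toggle-head (R p) ⟩
    ∑ₗ L (λ g → h′ (true ∷ g)) + ∑ₗ L (λ g → h′ (false ∷ g))         ≡⟨ sym (halves h′) ⟩
    ∑ₗ (allBoolVecs (suc (length ps))) h′                              ∎
    where
    open ≡-Reasoning
    L : List (Vec Bool (length ps))
    L = allBoolVecs (length ps)
    h′ : Vec Bool (suc (length ps)) → ℕ
    h′ g = h (toggle R (p ∷ ps) g)
    halves : (k : Vec Bool (suc (length ps)) → ℕ) →
             ∑ₗ (allBoolVecs (suc (length ps))) k ≡ ∑ₗ L (λ g → k (true ∷ g)) + ∑ₗ L (λ g → k (false ∷ g))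
    halves k = trans (∑ₗ-++ (map (true ∷_) L) (map (false ∷_) L) k) (cong₂ _+_ (∑ₗ-map (true ∷_) L k) (∑ₗ-map (false ∷_) L k))
    -- on each half the tail is toggled by induction; toggling the head swaps the halves
    toggle-head : (c : Bool) → ∑ₗ L (λ g → h (true ∷ g)) + ∑ₗ L (λ g → h (false ∷ g)) ≡
      ∑ₗ L (λ g → h ((c xor true) ∷ toggle R ps g)) + ∑ₗ L (λ g → h ((c xor false) ∷ toggle R ps g))
    toggle-head false = cong₂ _+_ (toggle-invariance R ps (λ g → h (true ∷ g))) (toggle-invariance R ps (λ g → h (false ∷ g)))
    toggle-head true = trans (+-comm (∑ₗ L (λ g → h (true ∷ g))) _)
      (cong₂ _+_ (toggle-invariance R ps (λ g → h (false ∷ g))) (toggle-invariance R ps (λ g → h (true ∷ g))))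

  toggle-nothing : (ps : List A) (g : Vec Bool (length ps)) → toggle (λ _ → false) ps g ≡ g
  toggle-nothing [] [] = refl
  toggle-nothing (p ∷ ps) (b ∷ g) = cong (b ∷_) (toggle-nothing ps g)

  ∑ₗ-select-complement : (ps : List A) (g : Vec Bool (length ps)) (f : A → ℕ) →
    ∑ₗ (select ps (toggle (λ _ → true) ps g)) f + ∑ₗ (select ps g) f ≡ ∑ₗ ps f
  ∑ₗ-select-complement [] [] f = refl
  ∑ₗ-select-complement (p ∷ ps) (true ∷ g) f =
    trans (x∙yz≈y∙xz (∑ₗ (select ps (toggle (λ _ → true) ps g)) f) (f p) _)
          (cong (f p +_) (∑ₗ-select-complement ps g f))
  ∑ₗ-select-complement (p ∷ ps) (false ∷ g) f =
    trans (+-assoc (f p) _ _) (cong (f p +_) (∑ₗ-select-complement ps g f))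

  ∑ₗ-select-toggle-local : (R R′ : A → Bool) (ps : List A) (g : Vec Bool (length ps)) (f : A → ℕ) →
    All (λ p → (R p ≡ R′ p) ⊎ (f p ≡ 0)) ps →
    ∑ₗ (select ps (toggle R ps g)) f ≡ ∑ₗ (select ps (toggle R′ ps g)) f
  ∑ₗ-select-toggle-local R R′ [] [] f [] = refl
  ∑ₗ-select-toggle-local R R′ (p ∷ ps) (b ∷ g) f (inj₁ R≡R′ ∷ agree) rewrite R≡R′ with R′ p xor b
  ... | true = cong (f p +_) (∑ₗ-select-toggle-local R R′ ps g f agree)
  ... | false = ∑ₗ-select-toggle-local R R′ ps g f agree
  ∑ₗ-select-toggle-local R R′ (p ∷ ps) (b ∷ g) f (inj₂ fp≡0 ∷ agree) with R p xor b | R′ p xor b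
  ... | true | true = cong (f p +_) (∑ₗ-select-toggle-local R R′ ps g f agree)
  ... | true | false = trans (cong (_+ ∑ₗ (select ps (toggle R ps g)) f) fp≡0) (∑ₗ-select-toggle-local R R′ ps g f agree)
  ... | false | true = trans (∑ₗ-select-toggle-local R R′ ps g f agree) (cong (_+ ∑ₗ (select ps (toggle R′ ps g)) f) (sym fp≡0))
  ... | false | false = ∑ₗ-select-toggle-local R R′ ps g f agree

record PairSet {n : ℕ} (R : Fin n → Fin n → Bool) : Set where
  field
    symmetric   : ∀ i j → R i j ≡ R j i
    irreflexive : ∀ i → R i i ≡ false

toggleGraph : ∀ {n} → (Fin n → Fin n → Bool) → Graph n → Graph n
toggleGraph {n} R g = toggle (λ p → R (proj₁ p) (proj₂ p)) (upperPairs n) g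

module _ {n : ℕ} {R : Fin n → Fin n → Bool} (pairSet : PairSet R) (g : Graph n) where

  open PairSet pairSet

  private
    ps : List (Fin n × Fin n)
    ps = upperPairs n
    A A′ : Fin n → Fin n → Bool
    A = adjacentᵇ g
    A′ = adjacentᵇ (toggleGraph R g)

  toggle-adjacent : (s t : Fin n) → A′ s t ≡ R s t xor A s t
  toggle-adjacent s t with s ≟F t
  ... | yes refl rewrite adjacent-irrefl (toggleGraph R g) s | irreflexive s | adjacent-irrefl g s = refl
  ... | no s≢t = ⟦⟧-injective (begin
    ⟦ A′ s t ⟧                                                                 ≡⟨ adjacency-count (toggleGraph R g) s t ⟩
    ∑ₗ (select ps (toggle (λ p → R (proj₁ p) (proj₂ p)) ps g)) count          ≡⟨ ∑ₗ-select-toggle-local _ _ ps g count (All.universal agree ps) ⟩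
    ∑ₗ (select ps (toggle (λ _ → R s t) ps g)) count                          ≡⟨ constant-toggle (R s t) ⟩
    ⟦ R s t xor A s t ⟧                                                        ∎)
    where
    open ≡-Reasoning
    count : Fin n × Fin n → ℕ
    count p = ⟦ isPair s t p ⟧
    -- only the pair {s,t} is counted, and R takes the value R s t there
    agree : ∀ p → (R (proj₁ p) (proj₂ p) ≡ R s t) ⊎ (count p ≡ 0)
    agree p with isPair s t p in e
    ... | false = inj₂ refl
    ... | true with isPair-sound s t p e
    ...   | inj₁ refl = inj₁ refl
    ...   | inj₂ refl = inj₁ (symmetric t s)
    constant-toggle : (c : Bool) → ∑ₗ (select ps (toggle (λ _ → c) ps g)) count ≡ ⟦ c xor A s t ⟧
    constant-toggle false = trans (cong (λ h → ∑ₗ (select ps h) count) (toggle-nothing ps g)) (sym (adjacency-count g s t))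
    constant-toggle true = complement (A s t) (begin
      ∑ₗ (select ps (toggle (λ _ → true) ps g)) count + ⟦ A s t ⟧             ≡⟨ cong (∑ₗ (select ps (toggle (λ _ → true) ps g)) count +_) (adjacency-count g s t) ⟩
      ∑ₗ (select ps (toggle (λ _ → true) ps g)) count + ∑ₗ (select ps g) count ≡⟨ ∑ₗ-select-complement ps g count ⟩
      ∑ₗ ps count                                                              ≡⟨ upperPairs-once s≢t ⟩
      1                                                                        ∎)
      where
      complement : ∀ {x} b → x + ⟦ b ⟧ ≡ 1 → x ≡ ⟦ not b ⟧
      complement true x+1≡1 = +-cancelʳ-≡ 1 _ 0 x+1≡1
      complement false x+0≡1 = trans (sym (+-identityʳ _)) x+0≡1

  toggle-degree : (i : Fin n) →
    ∑[ j < n ] ⟦ R i j ∧ A i j ⟧ ≡ ∑[ j < n ] ⟦ R i j ∧ not (A i j) ⟧ →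
    degree (toggleGraph R g) i ≡ degree g i
  toggle-degree i balanced = begin
    degree (toggleGraph R g) i       ≡⟨ degree-adjacency (toggleGraph R g) i ⟩
    ∑[ j < n ] ⟦ A′ i j ⟧            ≡⟨ sum-cong-≗ (λ j → cong ⟦_⟧ (toggle-adjacent i j)) ⟩
    ∑[ j < n ] ⟦ R i j xor A i j ⟧   ≡⟨ +-cancelʳ-≡ _ _ _ flipped ⟩
    ∑[ j < n ] ⟦ A i j ⟧             ≡⟨ degree-adjacency g i ⟨
    degree g i                       ∎
    where
    open ≡-Reasoning
    flipped : ∑[ j < n ] ⟦ R i j xor A i j ⟧ + ∑[ j < n ] ⟦ R i j ∧ A i j ⟧ ≡
              ∑[ j < n ] ⟦ A i j ⟧ + ∑[ j < n ] ⟦ R i j ∧ A i j ⟧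
    flipped = begin
      ∑[ j < n ] ⟦ R i j xor A i j ⟧ + ∑[ j < n ] ⟦ R i j ∧ A i j ⟧    ≡⟨ ∑-distrib-+ (λ j → ⟦ R i j xor A i j ⟧) (λ j → ⟦ R i j ∧ A i j ⟧) ⟨
      ∑[ j < n ] (⟦ R i j xor A i j ⟧ + ⟦ R i j ∧ A i j ⟧)             ≡⟨ sum-cong-≗ (λ j → ⟦xor⟧-balance (R i j) (A i j)) ⟩
      ∑[ j < n ] (⟦ A i j ⟧ + ⟦ R i j ∧ not (A i j) ⟧)                 ≡⟨ ∑-distrib-+ (λ j → ⟦ A i j ⟧) (λ j → ⟦ R i j ∧ not (A i j) ⟧) ⟩
      ∑[ j < n ] ⟦ A i j ⟧ + ∑[ j < n ] ⟦ R i j ∧ not (A i j) ⟧       ≡⟨ cong (∑[ j < n ] ⟦ A i j ⟧ +_) (sym balanced) ⟩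
      ∑[ j < n ] ⟦ A i j ⟧ + ∑[ j < n ] ⟦ R i j ∧ A i j ⟧             ∎

module _ {n : ℕ} (d : Fin n → ℕ) where

  maxDeg-bound : ∀ i → d i ≤ maxDeg d
  maxDeg-bound i = ≤-foldr-⊔ (∈-map⁺ d (∈-allFin i))

  degSum-∑ : degSum d ≡ ∑ d
  degSum-∑ = ∑ₗ-allFin n d

  hasDegSeq-sound : (g : Graph n) → hasDegSeqᵇ g d ≡ true → ∀ i → degree g i ≡ d i
  hasDegSeq-sound g e i = ≡ᵇ⇒≡ (degree g i) (d i)
    (All.lookup (all⁺ (λ k → degree g k ≡ᵇ d k) (allFin n) (subst T (sym e) tt)) (∈-allFin i))

  hasDegSeq-cong : (g g′ : Graph n) → (∀ i → degree g i ≡ degree g′ i) → hasDegSeqᵇ g d ≡ hasDegSeqᵇ g′ d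
  hasDegSeq-cong g g′ same = cong and (map-cong (λ i → cong (_≡ᵇ d i) (same i)) (allFin n))

  degree-≤-maxDeg : (g : Graph n) → hasDegSeqᵇ g d ≡ true → ∀ u → degree g u ≤ maxDeg d
  degree-≤-maxDeg g e u = subst (_≤ maxDeg d) (sym (hasDegSeq-sound g e u)) (maxDeg-bound u)

module Switching {n : ℕ} (d : Fin n → ℕ) (a v : Fin n) where

  private
    A : Graph n → Fin n → Fin n → Bool
    A = adjacentᵇ

  distinct : Fin n → Fin n → Bool
  distinct x y = not (a ==F v) ∧ (not (a ==F x) ∧ (not (a ==F y) ∧ (not (v ==F x) ∧ (not (v ==F y) ∧ not (x ==F y)))))

  record Distinct (x y : Fin n) : Set where
    field
      a≢v : a ≢ v
      a≢x : a ≢ x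
      a≢y : a ≢ y
      v≢x : v ≢ x
      v≢y : v ≢ y
      x≢y : x ≢ y

  distinct-sound : ∀ {x y} → distinct x y ≡ true → Distinct x y
  distinct-sound {x} {y} e =
    let av , e₁ = ∧-true e ; ax , e₂ = ∧-true e₁ ; ay , e₃ = ∧-true e₂
        vx , e₄ = ∧-true e₃ ; vy , xy = ∧-true e₄
    in record { a≢v = differ av ; a≢x = differ ax ; a≢y = differ ay
              ; v≢x = differ vx ; v≢y = differ vy ; x≢y = differ xy }
    where
    differ : ∀ {i j : Fin n} → not (i ==F j) ≡ true → i ≢ j
    differ {i} ne refl rewrite ==F-refl i = case ne of λ ()

  -- The four-cycle a – v – y – x – a: switching at (x , y) toggles these four pairs.
  cycle : Fin n → Fin n → Fin n → Fin n → Bool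
  cycle x y i j = isPair a v (i , j) ∨ (isPair x y (i , j) ∨ (isPair a x (i , j) ∨ isPair v y (i , j)))

  cycle-pairSet : ∀ {x y} → Distinct x y → PairSet (cycle x y)
  cycle-pairSet {x} {y} D = record
    { symmetric = λ i j → cong₂ _∨_ (isPair-flip a v i j) (cong₂ _∨_ (isPair-flip x y i j)
                            (cong₂ _∨_ (isPair-flip a x i j) (isPair-flip v y i j)))
    ; irreflexive = λ i → cong₂ _∨_ (isPair-diagonal a≢v i) (cong₂ _∨_ (isPair-diagonal x≢y i)
                            (cong₂ _∨_ (isPair-diagonal a≢x i) (isPair-diagonal v≢y i)))
    }
    where open Distinct D

  cycle-av : ∀ x y → cycle x y a v ≡ true
  cycle-av x y rewrite isPair-self a v = refl

  cycle-xy : ∀ x y → cycle x y x y ≡ true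
  cycle-xy x y rewrite isPair-self x y = ∨-zeroʳ _

  cycle-ax : ∀ x y → cycle x y a x ≡ true
  cycle-ax x y rewrite isPair-self a x | ∨-zeroʳ (isPair x y (a , x)) = ∨-zeroʳ _

  cycle-vy : ∀ x y → cycle x y v y ≡ true
  cycle-vy x y rewrite isPair-self v y | ∨-zeroʳ (isPair a x (v , y)) | ∨-zeroʳ (isPair x y (v , y)) = ∨-zeroʳ _

  switch : Fin n → Fin n → Graph n → Graph n
  switch x y = toggleGraph (cycle x y)

  forward : Graph n → Fin n → Fin n → Bool
  forward g x y = distinct x y ∧ (A g a v ∧ (A g x y ∧ (not (A g a x) ∧ not (A g v y))))

  backward : Graph n → Fin n → Fin n → Bool
  backward g x y = distinct x y ∧ (not (A g a v) ∧ (not (A g x y) ∧ (A g a x ∧ A g v y)))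

  switch-flips : ∀ {x y} → Distinct x y → ∀ g s t → cycle x y s t ≡ true → A (switch x y g) s t ≡ not (A g s t)
  switch-flips D g s t c = trans (toggle-adjacent (cycle-pairSet D) g s t) (cong (_xor A g s t) c)

  switch-reverses : ∀ g x y → backward (switch x y g) x y ≡ forward g x y
  switch-reverses g x y with distinct x y in e
  ... | false = refl
  ... | true = cong₂ _∧_ (unflips a v (cycle-av x y))
                 (cong₂ _∧_ (unflips x y (cycle-xy x y)) (cong₂ _∧_ (flips a x (cycle-ax x y)) (flips v y (cycle-vy x y))))
    where
    flips : ∀ s t → cycle x y s t ≡ true → A (switch x y g) s t ≡ not (A g s t)
    flips = switch-flips (distinct-sound e) g
    unflips : ∀ s t → cycle x y s t ≡ true → not (A (switch x y g) s t) ≡ A g s t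
    unflips s t c = trans (cong not (flips s t c)) (not-involutive (A g s t))

  cycle-balance : ∀ {x y} → Distinct x y → (F : Fin n → Fin n → Bool) → (∀ i j → F i j ≡ F j i) → ∀ i →
    ∑[ j < n ] ⟦ cycle x y i j ∧ F i j ⟧ ≡
      ends a v i * ⟦ F a v ⟧ + (ends x y i * ⟦ F x y ⟧ + (ends a x i * ⟦ F a x ⟧ + ends v y i * ⟦ F v y ⟧))
  cycle-balance {x} {y} D F F-sym i = begin
    ∑[ j < n ] ⟦ cycle x y i j ∧ F i j ⟧                        ≡⟨ sum-cong-≗ split ⟩
    ∑[ j < n ] (on a v j + (on x y j + (on a x j + on v y j)))  ≡⟨ ∑-distrib-+ (on a v) _ ⟩
    ∑ (on a v) + ∑[ j < n ] (on x y j + (on a x j + on v y j))  ≡⟨ cong (∑ (on a v) +_) (∑-distrib-+ (on x y) _) ⟩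
    ∑ (on a v) + (∑ (on x y) + ∑[ j < n ] (on a x j + on v y j)) ≡⟨ cong (λ z → ∑ (on a v) + (∑ (on x y) + z)) (∑-distrib-+ (on a x) (on v y)) ⟩
    ∑ (on a v) + (∑ (on x y) + (∑ (on a x) + ∑ (on v y)))       ≡⟨ cong₂ _+_ (per-pair a≢v) (cong₂ _+_ (per-pair x≢y) (cong₂ _+_ (per-pair a≢x) (per-pair v≢y))) ⟩
    ends a v i * ⟦ F a v ⟧ + (ends x y i * ⟦ F x y ⟧ + (ends a x i * ⟦ F a x ⟧ + ends v y i * ⟦ F v y ⟧)) ∎
    where
    open ≡-Reasoning
    open Distinct D
    on : Fin n → Fin n → Fin n → ℕ
    on s t j = ⟦ isPair s t (i , j) ∧ F i j ⟧
    per-pair : ∀ {s t} → s ≢ t → ∑ (on s t) ≡ ends s t i * ⟦ F s t ⟧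
    per-pair s≢t = ∑-isPair-∧ s≢t F F-sym i
    -- the four pairs of the cycle are pairwise different
    split : ∀ j → ⟦ cycle x y i j ∧ F i j ⟧ ≡ on a v j + (on x y j + (on a x j + on v y j))
    split j = begin
      ⟦ (m₁ ∨ (m₂ ∨ (m₃ ∨ m₄))) ∧ F i j ⟧                  ≡⟨ ⟦∨∧⟧-disjoint m₁ _ _ (∧-∨-false m₁ m₂ _ d₁₂ (∧-∨-false m₁ m₃ m₄ d₁₃ d₁₄)) ⟩
      on a v j + ⟦ (m₂ ∨ (m₃ ∨ m₄)) ∧ F i j ⟧              ≡⟨ cong (on a v j +_) (⟦∨∧⟧-disjoint m₂ _ _ (∧-∨-false m₂ m₃ m₄ d₂₃ d₂₄)) ⟩
      on a v j + (on x y j + ⟦ (m₃ ∨ m₄) ∧ F i j ⟧)        ≡⟨ cong (λ z → on a v j + (on x y j + z)) (⟦∨∧⟧-disjoint m₃ m₄ _ d₃₄) ⟩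
      on a v j + (on x y j + (on a x j + on v y j))         ∎
      where
      m₁ m₂ m₃ m₄ : Bool
      m₁ = isPair a v (i , j)
      m₂ = isPair x y (i , j)
      m₃ = isPair a x (i , j)
      m₄ = isPair v y (i , j)
      d₁₂ : m₁ ∧ m₂ ≡ false
      d₁₂ = isPair-disjoint (inj₁ a≢x) (inj₁ a≢y) (i , j)
      d₁₃ : m₁ ∧ m₃ ≡ false
      d₁₃ = isPair-disjoint (inj₂ v≢x) (inj₁ a≢x) (i , j)
      d₁₄ : m₁ ∧ m₄ ≡ false
      d₁₄ = isPair-disjoint (inj₁ a≢v) (inj₁ a≢y) (i , j)
      d₂₃ : m₂ ∧ m₃ ≡ false
      d₂₃ = isPair-disjoint (inj₁ (≢-sym a≢x)) (inj₂ (≢-sym a≢y)) (i , j)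
      d₂₄ : m₂ ∧ m₄ ≡ false
      d₂₄ = isPair-disjoint (inj₁ (≢-sym v≢x)) (inj₁ x≢y) (i , j)
      d₃₄ : m₃ ∧ m₄ ≡ false
      d₃₄ = isPair-disjoint (inj₁ a≢v) (inj₁ a≢y) (i , j)

  record Forward (g : Graph n) (x y : Fin n) : Set where
    field
      distinctness : Distinct x y
      av-edge      : A g a v ≡ true
      xy-edge      : A g x y ≡ true
      ax-non-edge  : A g a x ≡ false
      vy-non-edge  : A g v y ≡ false

  forward-sound : ∀ {g x y} → forward g x y ≡ true → Forward g x y
  forward-sound {g} {x} {y} e =
    let dist , e₁ = ∧-true e ; av , e₂ = ∧-true e₁ ; xy , e₃ = ∧-true e₂ ; ax , vy = ∧-true e₃
    in record { distinctness = distinct-sound dist ; av-edge = av ; xy-edge = xy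
              ; ax-non-edge = not-true ax ; vy-non-edge = not-true vy }
    where
    not-true : ∀ {b} → not b ≡ true → b ≡ false
    not-true {false} _ = refl

  -- Switching a forward configuration preserves all degrees: each vertex of the cycle
  -- loses one edge (av or xy) and gains one (ax or vy).
  switch-preserves-degree : ∀ g x y → forward g x y ≡ true → ∀ i → degree (switch x y g) i ≡ degree g i
  switch-preserves-degree g x y fw i = toggle-degree (cycle-pairSet distinctness) g i (begin
    ∑[ j < n ] ⟦ cycle x y i j ∧ A g i j ⟧
      ≡⟨ cycle-balance distinctness (A g) (adjacent-sym g) i ⟩
    ends a v i * ⟦ A g a v ⟧ + (ends x y i * ⟦ A g x y ⟧ + (ends a x i * ⟦ A g a x ⟧ + ends v y i * ⟦ A g v y ⟧))
      ≡⟨ one-in-one-out ⟩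
    ends a v i * ⟦ not (A g a v) ⟧ + (ends x y i * ⟦ not (A g x y) ⟧ + (ends a x i * ⟦ not (A g a x) ⟧ + ends v y i * ⟦ not (A g v y) ⟧))
      ≡⟨ cycle-balance distinctness (λ s t → not (A g s t)) (λ s t → cong not (adjacent-sym g s t)) i ⟨
    ∑[ j < n ] ⟦ cycle x y i j ∧ not (A g i j) ⟧ ∎)
    where
    open ≡-Reasoning
    open Forward (forward-sound fw)
    one-in-one-out : ends a v i * ⟦ A g a v ⟧ + (ends x y i * ⟦ A g x y ⟧ + (ends a x i * ⟦ A g a x ⟧ + ends v y i * ⟦ A g v y ⟧))
                   ≡ ends a v i * ⟦ not (A g a v) ⟧ + (ends x y i * ⟦ not (A g x y) ⟧ + (ends a x i * ⟦ not (A g a x) ⟧ + ends v y i * ⟦ not (A g v y) ⟧))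
    one-in-one-out rewrite av-edge | xy-edge | ax-non-edge | vy-non-edge =
      solve 4 (λ A V X Y → (A :+ V) :* con 1 :+ ((X :+ Y) :* con 1 :+ ((A :+ X) :* con 0 :+ (V :+ Y) :* con 0))
                        := (A :+ V) :* con 0 :+ ((X :+ Y) :* con 0 :+ ((A :+ X) :* con 1 :+ (V :+ Y) :* con 1)))
        refl ⟦ a ==F i ⟧ ⟦ v ==F i ⟧ ⟦ x ==F i ⟧ ⟦ y ==F i ⟧

  inG : Graph n → Bool
  inG g = hasDegSeqᵇ g d

  -- Switching is a bijection between the forward configurations at (x , y) in G(d) and
  -- the backward ones: toggling is invertible and preserves G(d) on forward configurations.
  switching-bijection : ∀ x y → ∑ₗ (allGraphs n) (λ g → ⟦ inG g ∧ backward g x y ⟧)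
                               ≡ ∑ₗ (allGraphs n) (λ g → ⟦ inG g ∧ forward g x y ⟧)
  switching-bijection x y =
    trans (toggle-invariance _ (upperPairs n) (λ g → ⟦ inG g ∧ backward g x y ⟧)) (∑ₗ-cong (allGraphs n) switched)
    where
    switched : ∀ g → ⟦ inG (switch x y g) ∧ backward (switch x y g) x y ⟧ ≡ ⟦ inG g ∧ forward g x y ⟧
    switched g rewrite switch-reverses g x y with forward g x y in fw
    ... | false = cong ⟦_⟧ (trans (∧-zeroʳ _) (sym (∧-zeroʳ _)))
    ... | true = cong (λ b → ⟦ b ∧ true ⟧) (hasDegSeq-cong d (switch x y g) g (switch-preserves-degree g x y fw))

  forwardCount backwardCount : Graph n → ℕ
  forwardCount g = ∑[ x < n ] ∑[ y < n ] ⟦ forward g x y ⟧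
  backwardCount g = ∑[ x < n ] ∑[ y < n ] ⟦ backward g x y ⟧

  double-counting : ∑ₗ (allGraphs n) (λ g → ⟦ inG g ⟧ * forwardCount g) ≡ ∑ₗ (allGraphs n) (λ g → ⟦ inG g ⟧ * backwardCount g)
  double-counting = begin
    ∑ₗ L (λ g → ⟦ inG g ⟧ * forwardCount g)                        ≡⟨ by-configuration forward ⟩
    ∑[ x < n ] ∑[ y < n ] ∑ₗ L (λ g → ⟦ inG g ∧ forward g x y ⟧)   ≡⟨ sum-cong-≗ (λ x → sum-cong-≗ (λ y → switching-bijection x y)) ⟨
    ∑[ x < n ] ∑[ y < n ] ∑ₗ L (λ g → ⟦ inG g ∧ backward g x y ⟧)  ≡⟨ by-configuration backward ⟨
    ∑ₗ L (λ g → ⟦ inG g ⟧ * backwardCount g)                       ∎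
    where
    open ≡-Reasoning
    L : List (Graph n)
    L = allGraphs n
    by-configuration : (P : Graph n → Fin n → Fin n → Bool) →
      ∑ₗ L (λ g → ⟦ inG g ⟧ * ∑[ x < n ] ∑[ y < n ] ⟦ P g x y ⟧) ≡ ∑[ x < n ] ∑[ y < n ] ∑ₗ L (λ g → ⟦ inG g ∧ P g x y ⟧)
    by-configuration P = begin
      ∑ₗ L (λ g → ⟦ inG g ⟧ * ∑[ x < n ] ∑[ y < n ] ⟦ P g x y ⟧)  ≡⟨ ∑ₗ-cong L inside ⟩
      ∑ₗ L (λ g → ∑[ x < n ] ∑[ y < n ] ⟦ inG g ∧ P g x y ⟧)      ≡⟨ ∑ₗ-∑ L (λ g x → ∑[ y < n ] ⟦ inG g ∧ P g x y ⟧) ⟩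
      ∑[ x < n ] ∑ₗ L (λ g → ∑[ y < n ] ⟦ inG g ∧ P g x y ⟧)      ≡⟨ sum-cong-≗ (λ x → ∑ₗ-∑ L (λ g y → ⟦ inG g ∧ P g x y ⟧)) ⟩
      ∑[ x < n ] ∑[ y < n ] ∑ₗ L (λ g → ⟦ inG g ∧ P g x y ⟧)      ∎
      where
      inside : ∀ g → ⟦ inG g ⟧ * ∑[ x < n ] ∑[ y < n ] ⟦ P g x y ⟧ ≡ ∑[ x < n ] ∑[ y < n ] ⟦ inG g ∧ P g x y ⟧
      inside g = trans (*-distribˡ-sum ⟦ inG g ⟧ (λ x → ∑[ y < n ] ⟦ P g x y ⟧)) (sum-cong-≗ λ x →
                 trans (*-distribˡ-sum ⟦ inG g ⟧ (λ y → ⟦ P g x y ⟧)) (sum-cong-≗ λ y → sym (⟦∧⟧ (inG g) (P g x y))))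

  Δ dn : ℕ
  Δ = maxDeg d
  dn = degSum d

  near : Graph n → Fin n → Fin n → Bool
  near g u z = (z ==F u) ∨ A g u z

  near-degrees : ∀ g → inG g ≡ true → ∀ u → ∑[ z < n ] (⟦ near g u z ⟧ * degree g z) ≤ (1 + Δ) * Δ
  near-degrees g e u = begin
    ∑[ z < n ] (⟦ near g u z ⟧ * degree g z)     ≤⟨ ∑-mono (λ z → *-monoʳ-≤ ⟦ near g u z ⟧ (degree-≤-maxDeg d g e z)) ⟩
    ∑[ z < n ] (⟦ near g u z ⟧ * Δ)              ≡⟨ *-distribʳ-sum Δ (λ z → ⟦ near g u z ⟧) ⟨
    ∑[ z < n ] ⟦ near g u z ⟧ * Δ                ≤⟨ *-monoˡ-≤ Δ size ⟩
    (1 + Δ) * Δ                                  ∎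
    where
    open ≤-Reasoning
    size : ∑[ z < n ] ⟦ near g u z ⟧ ≤ 1 + Δ
    size = begin
      ∑[ z < n ] ⟦ near g u z ⟧                       ≤⟨ ∑-mono (λ z → ⟦∨⟧-≤ (z ==F u) (A g u z)) ⟩
      ∑[ z < n ] (⟦ z ==F u ⟧ + ⟦ A g u z ⟧)         ≡⟨ ∑-distrib-+ (λ z → ⟦ z ==F u ⟧) (λ z → ⟦ A g u z ⟧) ⟩
      ∑[ z < n ] ⟦ z ==F u ⟧ + ∑[ z < n ] ⟦ A g u z ⟧ ≡⟨ cong₂ _+_ (trans (sum-cong-≗ (λ z → cong ⟦_⟧ (==F-sym z u))) (∑-indicator u))
                                                                   (sym (degree-adjacency g u)) ⟩
      1 + degree g u                                   ≤⟨ +-monoʳ-≤ 1 (degree-≤-maxDeg d g e u) ⟩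
      1 + Δ                                            ∎

  near-edges : ∀ g → inG g ≡ true → ∀ u → ∑[ x < n ] ∑[ y < n ] (⟦ near g u x ⟧ * ⟦ A g x y ⟧) ≤ (1 + Δ) * Δ
  near-edges g e u = begin
    ∑[ x < n ] ∑[ y < n ] (⟦ near g u x ⟧ * ⟦ A g x y ⟧)  ≡⟨ sum-cong-≗ (λ x → *-distribˡ-sum ⟦ near g u x ⟧ (λ y → ⟦ A g x y ⟧)) ⟨
    ∑[ x < n ] (⟦ near g u x ⟧ * ∑[ y < n ] ⟦ A g x y ⟧)  ≡⟨ sum-cong-≗ (λ x → cong (⟦ near g u x ⟧ *_) (degree-adjacency g x)) ⟨
    ∑[ x < n ] (⟦ near g u x ⟧ * degree g x)               ≤⟨ near-degrees g e u ⟩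
    (1 + Δ) * Δ                                             ∎
    where open ≤-Reasoning

  forward-intro : ∀ {g x y} → Distinct x y → A g a v ≡ true → A g x y ≡ true → A g a x ≡ false → A g v y ≡ false →
                  forward g x y ≡ true
  forward-intro D av xy ax vy
    rewrite ==F-≢ (Distinct.a≢v D) | ==F-≢ (Distinct.a≢x D) | ==F-≢ (Distinct.a≢y D)
          | ==F-≢ (Distinct.v≢x D) | ==F-≢ (Distinct.v≢y D) | ==F-≢ (Distinct.x≢y D)
          | av | xy | ax | vy = refl

  forward-complete : ∀ g {x y} → A g a v ≡ true → A g x y ≡ true → near g a x ≡ false → near g v y ≡ false →
                     forward g x y ≡ true
  forward-complete g {x} {y} av xy nax nvy = forward-intro distinctness av xy ax vy
    where
    split-false : ∀ {b c} → b ∨ c ≡ false → (b ≡ false) × (c ≡ false)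
    split-false {false} {false} _ = refl , refl
    x≠a : (x ==F a) ≡ false
    x≠a = proj₁ (split-false nax)
    ax : A g a x ≡ false
    ax = proj₂ (split-false {x ==F a} nax)
    y≠v : (y ==F v) ≡ false
    y≠v = proj₁ (split-false nvy)
    vy : A g v y ≡ false
    vy = proj₂ (split-false {y ==F v} nvy)
    absurd : ∀ {b} → b ≡ true → b ≡ false → ∀ {P : Set} → P
    absurd refl ()
    distinctness : Distinct x y
    distinctness = record
      { a≢v = λ { refl → absurd av (adjacent-irrefl g a) }
      ; a≢x = λ { refl → absurd (==F-refl a) x≠a }
      ; a≢y = λ { refl → absurd (trans (adjacent-sym g v a) av) vy }
      ; v≢x = λ { refl → absurd av ax }
      ; v≢y = λ { refl → absurd (==F-refl v) y≠v }
      ; x≢y = λ { refl → absurd xy (adjacent-irrefl g x) } }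

  edge-classification : ∀ g → A g a v ≡ true → ∀ x y →
    ⟦ A g x y ⟧ ≤ ⟦ forward g x y ⟧ + (⟦ near g a x ⟧ * ⟦ A g x y ⟧ + ⟦ near g v y ⟧ * ⟦ A g x y ⟧)
  edge-classification g av x y = classify (forward g x y) (A g x y) (near g a x) (near g v y) (forward-complete g av)
    where
    classify : ∀ f e n₁ n₂ → (e ≡ true → n₁ ≡ false → n₂ ≡ false → f ≡ true) →
               ⟦ e ⟧ ≤ ⟦ f ⟧ + (⟦ n₁ ⟧ * ⟦ e ⟧ + ⟦ n₂ ⟧ * ⟦ e ⟧)
    classify f false n₁ n₂ _ = z≤n
    classify f true true n₂ _ = ≤-trans (s≤s z≤n) (m≤n+m _ ⟦ f ⟧)
    classify f true false true _ = m≤n+m 1 ⟦ f ⟧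
    classify f true false false complete rewrite complete refl refl refl = s≤s z≤n

  forward-lower : ∀ g → inG g ≡ true → A g a v ≡ true → dn ≤ forwardCount g + ((1 + Δ) * Δ + (1 + Δ) * Δ)
  forward-lower g e av = begin
    dn                                                          ≡⟨ degSum-∑ d ⟩
    ∑ d                                                         ≡⟨ sum-cong-≗ (λ x → trans (sym (hasDegSeq-sound d g e x)) (degree-adjacency g x)) ⟩
    ∑[ x < n ] ∑[ y < n ] ⟦ A g x y ⟧                           ≤⟨ ∑-mono (λ x → ∑-mono (edge-classification g av x)) ⟩
    ∑[ x < n ] ∑[ y < n ] (fw x y + (na x y + nv x y))          ≡⟨ ∑∑-distrib-+ ⟩
    forwardCount g + (∑[ x < n ] ∑[ y < n ] na x y + ∑[ x < n ] ∑[ y < n ] nv x y)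
                                                                ≤⟨ +-monoʳ-≤ (forwardCount g) (+-mono-≤ near-a near-v) ⟩
    forwardCount g + ((1 + Δ) * Δ + (1 + Δ) * Δ)               ∎
    where
    open ≤-Reasoning
    fw na nv : Fin n → Fin n → ℕ
    fw x y = ⟦ forward g x y ⟧
    na x y = ⟦ near g a x ⟧ * ⟦ A g x y ⟧
    nv x y = ⟦ near g v y ⟧ * ⟦ A g x y ⟧
    ∑∑-distrib-+ : ∑[ x < n ] ∑[ y < n ] (fw x y + (na x y + nv x y)) ≡
                   forwardCount g + (∑[ x < n ] ∑[ y < n ] na x y + ∑[ x < n ] ∑[ y < n ] nv x y)
    ∑∑-distrib-+ = begin-equality
      ∑[ x < n ] ∑[ y < n ] (fw x y + (na x y + nv x y))
        ≡⟨ sum-cong-≗ (λ x → trans (∑-distrib-+ (fw x) _) (cong (∑ (fw x) +_) (∑-distrib-+ (na x) (nv x)))) ⟩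
      ∑[ x < n ] (∑ (fw x) + (∑ (na x) + ∑ (nv x)))
        ≡⟨ trans (∑-distrib-+ (λ x → ∑ (fw x)) _) (cong (forwardCount g +_) (∑-distrib-+ (λ x → ∑ (na x)) (λ x → ∑ (nv x)))) ⟩
      forwardCount g + (∑[ x < n ] ∑[ y < n ] na x y + ∑[ x < n ] ∑[ y < n ] nv x y) ∎
    near-a : ∑[ x < n ] ∑[ y < n ] na x y ≤ (1 + Δ) * Δ
    near-a = near-edges g e a
    near-v : ∑[ x < n ] ∑[ y < n ] nv x y ≤ (1 + Δ) * Δ
    near-v = begin
      ∑[ x < n ] ∑[ y < n ] nv x y                                 ≡⟨ ∑-comm nv ⟩
      ∑[ y < n ] ∑[ x < n ] (⟦ near g v y ⟧ * ⟦ A g x y ⟧)        ≡⟨ sum-cong-≗ (λ y → sum-cong-≗ (λ x → cong (λ b → ⟦ near g v y ⟧ * ⟦ b ⟧) (adjacent-sym g x y))) ⟩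
      ∑[ y < n ] ∑[ x < n ] (⟦ near g v y ⟧ * ⟦ A g y x ⟧)        ≤⟨ near-edges g e v ⟩
      (1 + Δ) * Δ                                                  ∎

  -- Upper bound: a backward configuration at (x , y) needs av ∉ g, x ~ a and y ~ v.
  backward-upper : ∀ g → backwardCount g ≤ ⟦ not (A g a v) ⟧ * (degree g a * degree g v)
  backward-upper g = begin
    ∑[ x < n ] ∑[ y < n ] ⟦ backward g x y ⟧              ≤⟨ ∑-mono (λ x → ∑-mono (λ y → needs x y)) ⟩
    ∑[ x < n ] ∑[ y < n ] (c * (⟦ A g a x ⟧ * ⟦ A g v y ⟧)) ≡⟨ sum-cong-≗ (λ x → trans (sum-cong-≗ (λ y → sym (*-assoc c ⟦ A g a x ⟧ ⟦ A g v y ⟧)))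
                                                              (sym (*-distribˡ-sum (c * ⟦ A g a x ⟧) (λ y → ⟦ A g v y ⟧)))) ⟩
    ∑[ x < n ] (c * ⟦ A g a x ⟧ * ∑[ y < n ] ⟦ A g v y ⟧)  ≡⟨ sym (*-distribʳ-sum (∑[ y < n ] ⟦ A g v y ⟧) (λ x → c * ⟦ A g a x ⟧)) ⟩
    ∑[ x < n ] (c * ⟦ A g a x ⟧) * ∑[ y < n ] ⟦ A g v y ⟧  ≡⟨ cong₂ _*_ (sym (*-distribˡ-sum c (λ x → ⟦ A g a x ⟧))) (sym (degree-adjacency g v)) ⟩
    c * ∑[ x < n ] ⟦ A g a x ⟧ * degree g v                ≡⟨ cong (λ z → c * z * degree g v) (sym (degree-adjacency g a)) ⟩
    c * degree g a * degree g v                             ≡⟨ *-assoc c (degree g a) (degree g v) ⟩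
    c * (degree g a * degree g v)                           ∎
    where
    open ≤-Reasoning
    c : ℕ
    c = ⟦ not (A g a v) ⟧
    needs : ∀ x y → ⟦ backward g x y ⟧ ≤ c * (⟦ A g a x ⟧ * ⟦ A g v y ⟧)
    needs x y = weaken (distinct x y) (not (A g a v)) (not (A g x y)) (A g a x) (A g v y)
      where
      weaken : ∀ b p q r₁ r₂ → ⟦ b ∧ (p ∧ (q ∧ (r₁ ∧ r₂))) ⟧ ≤ ⟦ p ⟧ * (⟦ r₁ ⟧ * ⟦ r₂ ⟧)
      weaken false p q r₁ r₂ = z≤n
      weaken true false q r₁ r₂ = z≤n
      weaken true true false r₁ r₂ = z≤n
      weaken true true true r₁ r₂ = ≤-reflexive (trans (⟦∧⟧ r₁ r₂) (sym (*-identityˡ _)))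

  withEdge withoutEdge : ℕ
  withEdge = ∑ₗ (allGraphs n) (λ g → ⟦ inG g ∧ A g a v ⟧)
  withoutEdge = ∑ₗ (allGraphs n) (λ g → ⟦ inG g ∧ not (A g a v) ⟧)

  switching-inequality : withEdge * dn ≤ withoutEdge * (Δ * Δ) + withEdge * ((1 + Δ) * Δ + (1 + Δ) * Δ)
  switching-inequality = begin
    withEdge * dn                                          ≡⟨ ∑ₗ-*ʳ L (λ g → ⟦ inG g ∧ A g a v ⟧) dn ⟨
    ∑ₗ L (λ g → ⟦ inG g ∧ A g a v ⟧ * dn)                 ≤⟨ ∑ₗ-mono L lower ⟩
    ∑ₗ L (λ g → ⟦ inG g ⟧ * forwardCount g + ⟦ inG g ∧ A g a v ⟧ * 2K)
                                                           ≡⟨ ∑ₗ-+ L (λ g → ⟦ inG g ⟧ * forwardCount g) _ ⟩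
    ∑ₗ L (λ g → ⟦ inG g ⟧ * forwardCount g) + ∑ₗ L (λ g → ⟦ inG g ∧ A g a v ⟧ * 2K)
                                                           ≡⟨ cong₂ _+_ double-counting (∑ₗ-*ʳ L (λ g → ⟦ inG g ∧ A g a v ⟧) 2K) ⟩
    ∑ₗ L (λ g → ⟦ inG g ⟧ * backwardCount g) + withEdge * 2K
                                                           ≤⟨ +-monoˡ-≤ (withEdge * 2K) (∑ₗ-mono L upper) ⟩
    ∑ₗ L (λ g → ⟦ inG g ∧ not (A g a v) ⟧ * (Δ * Δ)) + withEdge * 2K
                                                           ≡⟨ cong (_+ withEdge * 2K) (∑ₗ-*ʳ L (λ g → ⟦ inG g ∧ not (A g a v) ⟧) (Δ * Δ)) ⟩
    withoutEdge * (Δ * Δ) + withEdge * 2K                  ∎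
    where
    open ≤-Reasoning
    L : List (Graph n)
    L = allGraphs n
    2K : ℕ
    2K = (1 + Δ) * Δ + (1 + Δ) * Δ
    lower : ∀ g → ⟦ inG g ∧ A g a v ⟧ * dn ≤ ⟦ inG g ⟧ * forwardCount g + ⟦ inG g ∧ A g a v ⟧ * 2K
    lower g = ⟦∧⟧*-bound (inG g) (A g a v) (forward-lower g)
    upper : ∀ g → ⟦ inG g ⟧ * backwardCount g ≤ ⟦ inG g ∧ not (A g a v) ⟧ * (Δ * Δ)
    upper g = ⟦⟧*-bound (inG g) (not (A g a v)) λ e → begin
      backwardCount g                                    ≤⟨ backward-upper g ⟩
      ⟦ not (A g a v) ⟧ * (degree g a * degree g v)      ≤⟨ *-monoʳ-≤ ⟦ not (A g a v) ⟧ (*-mono-≤ (degree-≤-maxDeg d g e a) (degree-≤-maxDeg d g e v)) ⟩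
      ⟦ not (A g a v) ⟧ * (Δ * Δ)                        ∎

  count-with-edge : numGraphsWithEdge d a v ≡ withEdge
  count-with-edge = trans (length-filter _ (allGraphs n)) (∑ₗ-cong (allGraphs n) (λ g → ⟦does⟧ (inG g ∧ A g a v)))

  count-all : numGraphs d ≡ withEdge + withoutEdge
  count-all = begin
    numGraphs d                                                             ≡⟨ length-filter _ (allGraphs n) ⟩
    ∑ₗ (allGraphs n) (λ g → ⟦ does (inG g Bool.≟ true) ⟧)                  ≡⟨ ∑ₗ-cong (allGraphs n) (λ g → trans (⟦does⟧ (inG g)) (by-edge (inG g) (A g a v))) ⟩
    ∑ₗ (allGraphs n) (λ g → ⟦ inG g ∧ A g a v ⟧ + ⟦ inG g ∧ not (A g a v) ⟧) ≡⟨ ∑ₗ-+ (allGraphs n) _ _ ⟩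
    withEdge + withoutEdge                                                  ∎
    where
    open ≡-Reasoning
    by-edge : ∀ b c → ⟦ b ⟧ ≡ ⟦ b ∧ c ⟧ + ⟦ b ∧ not c ⟧
    by-edge true true = refl
    by-edge true false = refl
    by-edge false c = refl

-- The statement: cross-multiplied, P_av(d) ≤ Δ² / (dn − Δ(Δ + 2)).  The inequality holds for
-- every d; graphicality and Δ(Δ + 2) < dn only make it a statement about a probability.
lemma2p3 : (n : ℕ) (d : Fin n → ℕ) → Graphical d →
    maxDeg d * (maxDeg d + 2) < degSum d →
    (a v : Fin n) →
    numGraphsWithEdge d a v * (degSum d ∸ maxDeg d * (maxDeg d + 2))
      ≤ (maxDeg d * maxDeg d) * numGraphs d
lemma2p3 n d _ _ a v = begin
  numGraphsWithEdge d a v * (dn ∸ Δ * (Δ + 2))  ≡⟨ cong (_* (dn ∸ Δ * (Δ + 2))) count-with-edge ⟩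
  K₁ * (dn ∸ Δ * (Δ + 2))                       ≡⟨ *-distribˡ-∸ K₁ dn (Δ * (Δ + 2)) ⟩
  K₁ * dn ∸ K₁ * (Δ * (Δ + 2))                  ≤⟨ m≤n+o⇒m∸n≤o (K₁ * dn) (K₁ * (Δ * (Δ + 2))) (≤-trans switching-inequality (≤-reflexive rearrange)) ⟩
  Δ * Δ * (K₁ + K₀)                             ≡⟨ cong (Δ * Δ *_) count-all ⟨
  Δ * Δ * numGraphs d                           ∎
  where
  open ≤-Reasoning
  open Switching d a v
  K₁ K₀ : ℕ
  K₁ = withEdge
  K₀ = withoutEdge
  -- 2(1 + Δ)Δ = Δ(Δ + 2) + Δ²
  rearrange : K₀ * (Δ * Δ) + K₁ * ((1 + Δ) * Δ + (1 + Δ) * Δ) ≡ K₁ * (Δ * (Δ + 2)) + Δ * Δ * (K₁ + K₀)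
  rearrange = solve 3 (λ k₀ k₁ δ → k₀ :* (δ :* δ) :+ k₁ :* ((con 1 :+ δ) :* δ :+ (con 1 :+ δ) :* δ)
                                 := k₁ :* (δ :* (δ :+ con 2)) :+ δ :* δ :* (k₁ :+ k₀)) refl K₀ K₁ Δ
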